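{- Let $A,B,C$ be sets. For each object $\Omega$ of $\mathbb{S}\mathsf{ur}$ let $\perp\!\!\!\perp_{A,B|C}(\Omega)$ be the set of triples $(X,Y,Z)$ of functions $X\colon\Omega\to A$, $Y\colon\Omega\to B$, $Z\colon\Omega\to C$ such that for all $a\in A,b\in B,c\in C$: if there is $\omega\in\Omega$ with $X(\omega)=a$, $Z(\omega)=c$ and there is $\omega\in\Omega$ with $Y(\omega)=b$, $Z(\omega)=c$, then there is $\omega\in\Omega$ with $X(\omega)=a$, $Y(\omega)=b$, $Z(\omega)=c$. Then $\perp\!\!\!\perp_{A,B|C}$ is a subsheaf of $\mathsf{NV}(A)\times\mathsf{NV}(B)\times\mathsf{NV}(C)$: for every surjection $p\colon\Omega'\to\Omega$, $(X,Y,Z)\in\perp\!\!\!\perp_{A,B|C}(\Omega)$ if and only if $(X\circ p,Y\circ p,Z\circ p)\in\perp\!\!\!\perp_{A,B|C}(\Omega')$.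
   Context: $\mathbb{S}\mathsf{ur}$ is the category of nonempty finite sets and surjections. $\mathsf{NV}(A)$ is the atomic sheaf on $\mathbb{S}\mathsf{ur}$ with $\mathsf{NV}(A)(\Omega)$ the set of functions $\Omega\to A$ and restriction given by precomposition. A family of subsets of a sheaf defines a subsheaf precisely when it is closed under restriction and reflected by restriction along every morphism. -}

module Defs where

open import Level using (Level; _⊔_)
open import Data.Nat using (ℕ; suc)
open import Data.Fin using (Fin)
open import Data.Product using (Σ; _×_; _,_; ∃)
open import Relation.Binary.PropositionalEquality using (_≡_)

-- Objects of Sur: nonempty finite sets, represented (up to isomorphism)
-- by the skeleton  Fin (suc n).
Obj : Set
Obj = ℕ

∣_∣ : Obj → Set
∣ n ∣ = Fin (suc n)

IsSurjection : {n m : Obj} → (∣ m ∣ → ∣ n ∣) → Set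
IsSurjection {n} {m} p = (ω : ∣ n ∣) → Σ ∣ m ∣ λ ω′ → p ω′ ≡ ω

NV : ∀ {a} → Set a → Obj → Set a
NV A Ω = ∣ Ω ∣ → A

CondIndep : ∀ {a b c} (A : Set a) (B : Set b) (C : Set c) (Ω : Obj) →
            NV A Ω → NV B Ω → NV C Ω → Set (a ⊔ b ⊔ c)
CondIndep A B C Ω X Y Z =
  (x : A) (y : B) (z : C) →
  (Σ ∣ Ω ∣ λ ω → X ω ≡ x × Z ω ≡ z) →
  (Σ ∣ Ω ∣ λ ω → Y ω ≡ y × Z ω ≡ z) →
  Σ ∣ Ω ∣ λ ω → X ω ≡ x × Y ω ≡ y × Z ω ≡ z

module Submission where

open import Defs
open import Function using (_∘_)
open import Function.Bundles using (_⇔_; mk⇔; Equivalence)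
open import Function.Related.TypeIsomorphisms using (→-cong-⇔)
open import Data.Product using (Σ; _×_; _,_)
open import Relation.Binary.PropositionalEquality using (_≡_; subst; sym)

-- Each clause of CondIndep is an implication between statements "some ω has
-- property P", and precomposing with p turns P into P ∘ p.  Along a surjection
-- such existence statements are equivalent, hence so are the implications.

Σ-⇔-precompose-surjection : ∀ {ℓ} {Ω Ω′ : Obj} {p : ∣ Ω′ ∣ → ∣ Ω ∣} →
  IsSurjection p → (P : ∣ Ω ∣ → Set ℓ) → (Σ ∣ Ω ∣ P) ⇔ (Σ ∣ Ω′ ∣ (P ∘ p))
Σ-⇔-precompose-surjection {p = p} surj P = mk⇔ lift (λ (ω′ , Pω) → p ω′ , Pω)
  where
  lift : Σ _ P → Σ _ (P ∘ p)
  lift (ω , Pω) with surj ω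
  ... | ω′ , pω′≡ω = ω′ , subst P (sym pω′≡ω) Pω

proposition4p9 : ∀ {a b c} (A : Set a) (B : Set b) (C : Set c)
    (Ω Ω′ : Obj) (p : ∣ Ω′ ∣ → ∣ Ω ∣) → IsSurjection p →
    (X : NV A Ω) (Y : NV B Ω) (Z : NV C Ω) →
    CondIndep A B C Ω X Y Z ⇔ CondIndep A B C Ω′ (X ∘ p) (Y ∘ p) (Z ∘ p)
proposition4p9 A B C Ω Ω′ p surj X Y Z =
  mk⇔ (λ h x y z → Equivalence.to (clause x y z) (h x y z))
      (λ h x y z → Equivalence.from (clause x y z) (h x y z))
  where
  reindex : ∀ {ℓ} (P : ∣ Ω ∣ → Set ℓ) → (Σ ∣ Ω ∣ P) ⇔ (Σ ∣ Ω′ ∣ (P ∘ p))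
  reindex = Σ-⇔-precompose-surjection surj
  clause : ∀ x y z →
    ((Σ ∣ Ω ∣ λ ω → X ω ≡ x × Z ω ≡ z) → (Σ ∣ Ω ∣ λ ω → Y ω ≡ y × Z ω ≡ z) →
      Σ ∣ Ω ∣ λ ω → X ω ≡ x × Y ω ≡ y × Z ω ≡ z)
    ⇔ ((Σ ∣ Ω′ ∣ λ ω → X (p ω) ≡ x × Z (p ω) ≡ z) →
       (Σ ∣ Ω′ ∣ λ ω → Y (p ω) ≡ y × Z (p ω) ≡ z) →
      Σ ∣ Ω′ ∣ λ ω → X (p ω) ≡ x × Y (p ω) ≡ y × Z (p ω) ≡ z)
  clause x y z =
    →-cong-⇔ (reindex (λ ω → X ω ≡ x × Z ω ≡ z))
      (→-cong-⇔ (reindex (λ ω → Y ω ≡ y × Z ω ≡ z))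
        (reindex (λ ω → X ω ≡ x × Y ω ≡ y × Z ω ≡ z)))
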